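{- For every $n\ge1$, $|\mathrm{Mono}_n|=\frac{1}{n+1}\binom{2n}{n}$, the $n$th Catalan number.
   Context: $[a,b]=\{i\in\mathbb Z:a\le i\le b\}$. A partition matrix on $[1,n]$ is a square upper triangular matrix whose entries are subsets of $[1,n]$ such that: (i) every row and column contains a non-empty entry; (ii) the non-empty entries partition $[1,n]$; (iii) $\mathrm{col}(i)<\mathrm{col}(j)$ implies $i<j$, where $\mathrm{col}(i)$ and $\mathrm{row}(i)$ denote the column and row indices of the entry containing $i$. $\mathrm{Mono}_n$ is the set of partition matrices on $[1,n]$ which also satisfy (iv) $\mathrm{row}(i)<\mathrm{row}(j)$ implies $i<j$. -}

module Defs where

open import Data.Nat using (ℕ; suc; _*_)
open import Data.Nat.DivMod using (_/_)
open import Data.Nat.Combinatorics using (_C_)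
open import Data.Fin using (Fin; _<_)
open import Data.Fin.Subset using (Subset; _∈_; Nonempty; ⊥)
open import Data.Vec using (Vec; lookup)
open import Data.Product using (Σ; ∃-syntax; _×_)
open import Relation.Binary.PropositionalEquality using (_≡_)

-- Elements of [1,n] are represented by Fin n (i ↦ i-1, order preserving).
-- A square matrix of size m with entries subsets of [1,n].
SqMat : ℕ → ℕ → Set
SqMat n m = Vec (Vec (Subset n) m) m

Matrix : ℕ → Set
Matrix n = Σ ℕ (SqMat n)

entry : ∀ {n m} → SqMat n m → Fin m → Fin m → Subset n
entry M r c = lookup (lookup M r) c

record IsPartitionMatrix {n m : ℕ} (M : SqMat n m) : Set where
  field
    upperTriangular : ∀ (r c : Fin m) → c < r → entry M r c ≡ ⊥
    rowNonempty : ∀ (r : Fin m) → ∃[ c ] Nonempty (entry M r c)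
    colNonempty : ∀ (c : Fin m) → ∃[ r ] Nonempty (entry M r c)
    covers : ∀ (i : Fin n) → ∃[ r ] ∃[ c ] (i ∈ entry M r c)
    disjoint : ∀ (i : Fin n) (r c r′ c′ : Fin m) →
      i ∈ entry M r c → i ∈ entry M r′ c′ → (r ≡ r′ × c ≡ c′)
    colOrder : ∀ (i j : Fin n) (r c r′ c′ : Fin m) →
      i ∈ entry M r c → j ∈ entry M r′ c′ → c < c′ → i < j

record IsMono {n : ℕ} (A : Matrix n) : Set where
  field
    partitionMatrix : IsPartitionMatrix (Σ.proj₂ A)
    rowOrder : ∀ (i j : Fin n) (r c r′ c′ : Fin (Σ.proj₁ A)) →
      i ∈ entry (Σ.proj₂ A) r c → j ∈ entry (Σ.proj₂ A) r′ c′ → r < r′ → i < j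

catalan : ℕ → ℕ
catalan n = ((2 * n) C n) / suc n

module Submission where

open import Defs
open import Data.Nat using (ℕ; _≥_; _≤_)
open import Data.List using (List; length)
open import Data.List.Membership.Propositional using (_∈_)
open import Data.List.Relation.Unary.Unique.Propositional using (Unique)
open import Data.Product using (∃-syntax; _×_)
open import Function.Bundles using (_⇔_)
open import Relation.Binary.PropositionalEquality using (_≡_)
open import Data.Nat using (suc)
open import Data.List using (map)
open import Data.List.Properties using (length-map)
open import Data.List.Membership.Propositional.Properties using (∈-map⁺; ∈-map⁻)
open import Data.Product using (_,_; proj₁; proj₂)
open import Function.Bundles using (mk⇔)
open import Relation.Binary.PropositionalEquality using (sym; trans; subst)

-- Reading the elements 1, 2, …, N+1 of a member of Mono_{N+1} in increasing
-- order, conditions (iii) and (iv) make their row and column indices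
-- non-decreasing, and non-empty rows and columns forbid jumps; so the cell of
-- the next element is reached by one of four moves: stay, diagonal, east
-- (column + 1) or south (row + 1).  Upper triangularity and squareness say that
-- the excess "column − row" never becomes negative and ends at 0.  Hence
-- Mono_{N+1} corresponds to words of length N in which east and south are up-
-- and down-steps of a path from height 0 back to 0 (MoveWords), and these are
-- counted by pathCount N 0, which a ballot-type identity proved from Pascal's
-- rule identifies with Catalan(N+1) (Counting).

module Counting where

  open import Data.Nat
  open import Data.Nat.Properties
  open import Data.Nat.Combinatorics using (_C_; nCk≡nC[n∸k]; nC1≡n)
    renaming (nCk+nC[k+1]≡[n+1]C[k+1] to pascal)
  open import Data.Nat.DivMod using (_/_; m*n/n≡m)
  open import Data.Nat.Tactic.RingSolver using (solve-∀)
  open import Relation.Binary.PropositionalEquality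
  open ≡-Reasoning

  pascal² : ∀ n k →
    suc (suc n) C suc (suc k) ≡ n C k + (n C suc k + n C suc k) + n C suc (suc k)
  pascal² n k = begin
    suc (suc n) C suc (suc k)
      ≡⟨ pascal (suc n) (suc k) ⟨
    suc n C suc k + suc n C suc (suc k)
      ≡⟨ cong₂ _+_ (pascal n k) (pascal n (suc k)) ⟨
    (n C k + n C suc k) + (n C suc k + n C suc (suc k))
      ≡⟨ regroup (n C k) (n C suc k) (n C suc (suc k)) ⟩
    n C k + (n C suc k + n C suc k) + n C suc (suc k) ∎
    where
    regroup : ∀ a b c → (a + b) + (b + c) ≡ a + (b + b) + c
    regroup = solve-∀

  absorption : ∀ n k → suc k * (suc n C suc k) ≡ suc n * (n C k)
  absorption zero zero = refl
  absorption zero (suc k) = *-zeroʳ (suc (suc k))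
  absorption (suc n) zero = begin
    1 * (suc (suc n) C 1) ≡⟨ *-identityˡ _ ⟩
    suc (suc n) C 1       ≡⟨ nC1≡n (suc (suc n)) ⟩
    suc (suc n)           ≡⟨ *-identityʳ _ ⟨
    suc (suc n) * 1       ∎
  absorption (suc n) (suc k) = begin
    suc (suc k) * (suc (suc n) C suc (suc k))
      ≡⟨ cong (suc (suc k) *_) (pascal (suc n) (suc k)) ⟨
    suc (suc k) * (suc n C suc k + suc n C suc (suc k))
      ≡⟨ *-distribˡ-+ (suc (suc k)) (suc n C suc k) _ ⟩
    suc (suc k) * (suc n C suc k) + suc (suc k) * (suc n C suc (suc k))
      ≡⟨ cong₂ _+_ (cong (suc n C suc k +_) (absorption n k)) (absorption n (suc k)) ⟩
    suc n C suc k + suc n * (n C k) + suc n * (n C suc k)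
      ≡⟨ cong (λ x → x + suc n * (n C k) + suc n * (n C suc k)) (pascal n k) ⟨
    (n C k + n C suc k) + suc n * (n C k) + suc n * (n C suc k)
      ≡⟨ regroup n (n C k) (n C suc k) ⟩
    suc (suc n) * (n C k + n C suc k)
      ≡⟨ cong (suc (suc n) *_) (pascal n k) ⟩
    suc (suc n) * (suc n C suc k) ∎
    where
    regroup : ∀ n a b → (a + b) + suc n * a + suc n * b ≡ suc (suc n) * (a + b)
    regroup = solve-∀

  middleSymmetry : ∀ N → suc (N + N) C N ≡ suc (N + N) C suc N
  middleSymmetry N = begin
    suc (N + N) C N                 ≡⟨ nCk≡nC[n∸k] (≤-trans (m≤m+n N N) (n≤1+n _)) ⟩
    suc (N + N) C (suc (N + N) ∸ N) ≡⟨ cong (suc (N + N) C_) complement ⟩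
    suc (N + N) C suc N             ∎
    where
    complement : suc (N + N) ∸ N ≡ suc N
    complement = trans (+-∸-assoc 1 (m≤n+m N N)) (cong suc (m+n∸n≡m N N))

  -- pathCount N h counts the words of length N over four letters (two neutral,
  -- one raising and one lowering the height) that start at height h, never go
  -- below 0 and end at height 0; descentCount N h counts those beginning with a
  -- lowering letter, once that letter is removed.
  pathCount : ℕ → ℕ → ℕ
  descentCount : ℕ → ℕ → ℕ
  pathCount zero zero = 1
  pathCount zero (suc h) = 0
  pathCount (suc N) h = pathCount N h + pathCount N h + pathCount N (suc h) + descentCount N h
  descentCount N zero = 0
  descentCount N (suc h) = pathCount N h

  oddRow : ℕ → ℕ → ℕ
  oddRow N k = suc (N + N) C k

  -- The ballot-type formula pathCount N h = C(2N+1,N+h+1) − C(2N+1,N+h+2), in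
  -- subtraction-free form; it is proved by induction on N using Pascal's rule
  -- twice, the descent term being handled by middleSymmetry when h = 0.
  ballot : ∀ N h → pathCount N h + oddRow N (2 + (N + h)) ≡ oddRow N (1 + (N + h))
  descentBallot : ∀ N h → descentCount N h + oddRow N (1 + (N + h)) ≡ oddRow N (N + h)

  descentBallot N zero rewrite +-identityʳ N = sym (middleSymmetry N)
  descentBallot N (suc h) rewrite +-suc N h = ballot N h

  ballot zero zero = refl
  ballot zero (suc h) = refl
  ballot (suc N) h
    rewrite +-suc N N | pascal² (suc (N + N)) (suc (N + h)) | pascal² (suc (N + N)) (N + h) =
    linearStep (descentBallot N h) (ballot N h) ballotAbove
    where
    ballotAbove : pathCount N (suc h) + oddRow N (3 + (N + h)) ≡ oddRow N (2 + (N + h))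
    ballotAbove = subst (λ x → pathCount N (suc h) + oddRow N (2 + x) ≡ oddRow N (1 + x))
                        (+-suc N h) (ballot N (suc h))
    -- the recursion of pathCount matches that of the double Pascal rule
    linearStep : ∀ {a b d p q r s} → d + q ≡ p → a + r ≡ q → b + s ≡ r →
      (a + a + b + d) + (q + (r + r) + s) ≡ p + (q + q) + r
    linearStep {a} {b} {d} {s = s} refl refl refl = regroup a b d s
      where
      regroup : ∀ a b d s → (a + a + b + d) + ((a + (b + s)) + ((b + s) + (b + s)) + s)
                            ≡ (d + (a + (b + s))) + ((a + (b + s)) + (a + (b + s))) + (b + s)
      regroup = solve-∀

  -- Linear algebra behind the Catalan formula: if c + Y = X and
  -- (N+2)·(X+Y) = (2N+2)·X, then eliminating X leaves N·c = 2·Y, whence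
  -- (N+2)·c = 2·X.
  eliminate : ∀ N c Y {X} → c + Y ≡ X → (2 + N) * (X + Y) ≡ (2 + (N + N)) * X → c * (2 + N) ≡ X + X
  eliminate N c Y refl absorbed = begin
    c * (2 + N)          ≡⟨ expandCount N c ⟩
    c + c + N * c        ≡⟨ cong (c + c +_) Nc≡2Y ⟩
    c + c + (Y + Y)      ≡⟨ regroup c Y ⟩
    (c + Y) + (c + Y)    ∎
    where
    common : ℕ
    common = N * c + c + c + (N * Y + N * Y) + (Y + Y)
    expandCount : ∀ N c → c * (2 + N) ≡ c + c + N * c
    expandCount = solve-∀
    regroup : ∀ c Y → c + c + (Y + Y) ≡ (c + Y) + (c + Y)
    regroup = solve-∀
    expandL : ∀ N c Y → N * c + c + c + (N * Y + N * Y) + (Y + Y) + (Y + Y) ≡ (2 + N) * ((c + Y) + Y)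
    expandL = solve-∀
    expandR : ∀ N c Y → (2 + (N + N)) * (c + Y) ≡ N * c + c + c + (N * Y + N * Y) + (Y + Y) + N * c
    expandR = solve-∀
    Nc≡2Y : N * c ≡ Y + Y
    Nc≡2Y = sym (+-cancelˡ-≡ common (Y + Y) (N * c)
              (trans (expandL N c Y) (trans absorbed (expandR N c Y))))

  -- The number of paths from height 0 is the Catalan number:
  -- (N+2)·pathCount N 0 = C(2N+2,N+1).
  catalan≡pathCount : ∀ N → catalan (suc N) ≡ pathCount N 0
  catalan≡pathCount N = begin
    ((2 * suc N) C suc N) / suc (suc N)          ≡⟨ cong (λ x → (x C suc N) / suc (suc N)) twoN+2 ⟩
    (suc (suc (N + N)) C suc N) / suc (suc N)    ≡⟨ cong (_/ suc (suc N)) centralBinomial ⟨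
    pathCount N 0 * suc (suc N) / suc (suc N)    ≡⟨ m*n/n≡m (pathCount N 0) (suc (suc N)) ⟩
    pathCount N 0                                ∎
    where
    X Y : ℕ
    X = oddRow N (suc N)
    Y = oddRow N (suc (suc N))
    twoN+2 : 2 * suc N ≡ suc (suc (N + N))
    twoN+2 = cong suc (trans (+-suc N (N + 0)) (cong (λ x → suc (N + x)) (+-identityʳ N)))
    pathCount+Y : pathCount N 0 + Y ≡ X
    pathCount+Y = subst (λ x → pathCount N 0 + oddRow N (2 + x) ≡ oddRow N (1 + x))
                        (+-identityʳ N) (ballot N 0)
    -- (N+2)·C(2N+2,N+2) = (2N+2)·C(2N+1,N+1), expanded by Pascal's rule
    absorbed : (2 + N) * (X + Y) ≡ (2 + (N + N)) * X
    absorbed = trans (cong (suc (suc N) *_) (pascal (suc (N + N)) (suc N)))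
                     (absorption (suc (N + N)) (suc N))
    -- C(2N+2,N+1) = C(2N+1,N) + C(2N+1,N+1) = 2·X
    centralBinomial : pathCount N 0 * suc (suc N) ≡ suc (suc (N + N)) C suc N
    centralBinomial = begin
      pathCount N 0 * suc (suc N)  ≡⟨ eliminate N (pathCount N 0) Y pathCount+Y absorbed ⟩
      X + X                        ≡⟨ cong (_+ X) (middleSymmetry N) ⟨
      oddRow N N + X               ≡⟨ pascal (suc (N + N)) N ⟩
      suc (suc (N + N)) C suc N    ∎

module ListEnumeration where

  open import Data.Nat using (_+_)
  open import Data.List using (List; []; _∷_; _++_; map; length; foldr)
  open import Data.List.Properties using (length-++; length-map; ∷-injectiveʳ)
  open import Data.List.Membership.Propositional using (_∈_)
  open import Data.List.Membership.Propositional.Properties using (∈-map⁺; ∈-map⁻; ∈-++⁺ˡ; ∈-++⁺ʳ; ∈-++⁻)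
  open import Data.List.Relation.Unary.Any using (here; there)
  import Data.List.Relation.Unary.All as All
  import Data.List.Relation.Unary.All.Properties as AllProp
  open import Data.List.Relation.Unary.AllPairs using ([]; _∷_)
  open import Data.List.Relation.Unary.Unique.Propositional using (Unique)
  import Data.List.Relation.Unary.Unique.Propositional.Properties as Unique
  open import Data.Product using (∃-syntax; _×_; _,_)
  open import Data.Sum using (inj₁; inj₂)
  open import Relation.Nullary using (¬_)
  open import Relation.Binary.PropositionalEquality

  branch : {A : Set} → (A → List (List A)) → List A → List (List A)
  branch tails [] = []
  branch tails (x ∷ xs) = map (x ∷_) (tails x) ++ branch tails xs

  module _ {A : Set} (tails : A → List (List A)) where

    length-branch : ∀ xs → length (branch tails xs) ≡ foldr (λ x s → length (tails x) + s) 0 xs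
    length-branch [] = refl
    length-branch (x ∷ xs) = trans (length-++ (map (x ∷_) (tails x)))
      (cong₂ _+_ (length-map (x ∷_) (tails x)) (length-branch xs))

    ∈-branch⁺ : ∀ {xs x w} → x ∈ xs → w ∈ tails x → (x ∷ w) ∈ branch tails xs
    ∈-branch⁺ {x ∷ xs} (here refl) w∈ = ∈-++⁺ˡ (∈-map⁺ (x ∷_) w∈)
    ∈-branch⁺ {x ∷ xs} (there x∈) w∈ = ∈-++⁺ʳ (map (x ∷_) (tails x)) (∈-branch⁺ x∈ w∈)

    ∈-branch⁻ : ∀ xs {v} → v ∈ branch tails xs → ∃[ x ] ∃[ w ] (x ∈ xs × w ∈ tails x × v ≡ x ∷ w)
    ∈-branch⁻ (x ∷ xs) v∈ with ∈-++⁻ (map (x ∷_) (tails x)) v∈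
    ... | inj₁ v∈map = let w , w∈ , v≡ = ∈-map⁻ (x ∷_) v∈map in x , w , here refl , w∈ , v≡
    ... | inj₂ v∈rest = let y , w , y∈ , w∈ , v≡ = ∈-branch⁻ xs v∈rest in y , w , there y∈ , w∈ , v≡

    branch-unique : ∀ {xs} → Unique xs → (∀ x → Unique (tails x)) → Unique (branch tails xs)
    branch-unique {[]} [] _ = []
    branch-unique {x ∷ xs} (x∉xs ∷ xs!) tails! =
      Unique.++⁺ (Unique.map⁺ ∷-injectiveʳ (tails! x)) (branch-unique xs! tails!) disjoint
      where
      disjoint : ∀ {v} → ¬ (v ∈ map (x ∷_) (tails x) × v ∈ branch tails xs)
      disjoint (v∈map , v∈rest) with ∈-map⁻ (x ∷_) v∈map | ∈-branch⁻ xs v∈rest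
      ... | _ , _ , refl | y , _ , y∈ , _ , refl = All.lookup x∉xs y∈ refl

  map-unique : ∀ {A B : Set} (f : A → B) {xs : List A} →
    (∀ {x y} → x ∈ xs → y ∈ xs → f x ≡ f y → x ≡ y) → Unique xs → Unique (map f xs)
  map-unique f {[]} injective [] = []
  map-unique f {x ∷ xs} injective (x∉xs ∷ xs!) =
    AllProp.map⁺ (All.tabulate λ y∈ fx≡fy → All.lookup x∉xs y∈ (injective (here refl) (there y∈) fx≡fy)) ∷
    map-unique f (λ x∈ y∈ → injective (there x∈) (there y∈)) xs!

module MoveWords where

  open import Data.Nat
  open import Data.Nat.Properties
  open import Data.List using (List; []; _∷_; length)
  open import Data.List.Membership.Propositional using (_∈_)
  open import Data.List.Relation.Unary.Any using (here; there)
  import Data.List.Relation.Unary.All as All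
  open import Data.List.Relation.Unary.AllPairs using ([]; _∷_)
  open import Data.List.Relation.Unary.Unique.Propositional using (Unique)
  open import Data.Product using (∃-syntax; _×_; _,_; proj₁; proj₂)
  open import Data.Empty using (⊥)
  open import Data.Fin using (Fin; zero; suc; toℕ; inject₁)
  open import Function using (_∘_)
  open import Relation.Binary.PropositionalEquality
  open Counting using (pathCount; descentCount)
  open ListEnumeration using (branch; length-branch; ∈-branch⁺; ∈-branch⁻; branch-unique)

  -- Walking through [1,n] in increasing order, the cell containing i+1 is reached
  -- from the cell containing i by one of four moves.
  data Move : Set where
    stay diag east south : Move

  rowStep colStep : Move → ℕ
  rowStep stay = 0
  rowStep diag = 1
  rowStep east = 0
  rowStep south = 1
  colStep stay = 0
  colStep diag = 1
  colStep east = 1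
  colStep south = 0

  Word : Set
  Word = List Move

  allMoves : List Move
  allMoves = stay ∷ diag ∷ east ∷ south ∷ []

  ∈-allMoves : ∀ m → m ∈ allMoves
  ∈-allMoves stay = here refl
  ∈-allMoves diag = there (here refl)
  ∈-allMoves east = there (there (here refl))
  ∈-allMoves south = there (there (there (here refl)))

  allMoves-unique : Unique allMoves
  allMoves-unique =
    ((λ ()) All.∷ (λ ()) All.∷ (λ ()) All.∷ All.[]) ∷ ((λ ()) All.∷ (λ ()) All.∷ All.[]) ∷
    ((λ ()) All.∷ All.[]) ∷ All.[] ∷ []

  -- Valid h w: starting with h more columns than rows, the column index never
  -- falls behind the row index along w (upper triangularity) and the two agree
  -- at the end (the matrix is square).
  Valid : ℕ → Word → Set
  Valid h [] = h ≡ 0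
  Valid h (stay ∷ w) = Valid h w
  Valid h (diag ∷ w) = Valid h w
  Valid h (east ∷ w) = Valid (suc h) w
  Valid zero (south ∷ w) = ⊥
  Valid (suc h) (south ∷ w) = Valid h w

  words : ℕ → ℕ → List Word
  continuations : ℕ → ℕ → Move → List Word
  words zero zero = [] ∷ []
  words zero (suc h) = []
  words (suc N) h = branch (continuations N h) allMoves
  continuations N h stay = words N h
  continuations N h diag = words N h
  continuations N h east = words N (suc h)
  continuations N zero south = []
  continuations N (suc h) south = words N h

  words-sound : ∀ N h {w} → w ∈ words N h → length w ≡ N × Valid h w
  continuations-sound : ∀ N h m {w} → w ∈ continuations N h m → length w ≡ N × Valid h (m ∷ w)
  words-sound zero zero (here refl) = refl , refl
  words-sound (suc N) h w∈ with ∈-branch⁻ (continuations N h) allMoves w∈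
  ... | m , w , _ , w∈′ , refl = let len , valid = continuations-sound N h m w∈′ in cong suc len , valid
  continuations-sound N h stay w∈ = words-sound N h w∈
  continuations-sound N h diag w∈ = words-sound N h w∈
  continuations-sound N h east w∈ = words-sound N (suc h) w∈
  continuations-sound N (suc h) south w∈ = words-sound N h w∈

  words-complete : ∀ N h w → length w ≡ N → Valid h w → w ∈ words N h
  continuations-complete : ∀ N h m w → length w ≡ N → Valid h (m ∷ w) → w ∈ continuations N h m
  words-complete zero zero [] refl refl = here refl
  words-complete (suc N) h (m ∷ w) refl valid =
    ∈-branch⁺ (continuations N h) (∈-allMoves m) (continuations-complete N h m w refl valid)
  continuations-complete N h stay w refl valid = words-complete N h w refl valid
  continuations-complete N h diag w refl valid = words-complete N h w refl valid
  continuations-complete N h east w refl valid = words-complete N (suc h) w refl valid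
  continuations-complete N (suc h) south w refl valid = words-complete N h w refl valid

  words-unique : ∀ N h → Unique (words N h)
  continuations-unique : ∀ N h m → Unique (continuations N h m)
  words-unique zero zero = All.[] ∷ []
  words-unique zero (suc h) = []
  words-unique (suc N) h = branch-unique (continuations N h) allMoves-unique (continuations-unique N h)
  continuations-unique N h stay = words-unique N h
  continuations-unique N h diag = words-unique N h
  continuations-unique N h east = words-unique N (suc h)
  continuations-unique N zero south = []
  continuations-unique N (suc h) south = words-unique N h

  length-words : ∀ N h → length (words N h) ≡ pathCount N h
  length-words zero zero = refl
  length-words zero (suc h) = refl
  length-words (suc N) h = begin
    length (words (suc N) h)
      ≡⟨ length-branch (continuations N h) allMoves ⟩
    length (words N h) + (length (words N h) + (length (words N (suc h)) + (length (continuations N h south) + 0)))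
      ≡⟨ cong₂ (λ a b → a + (a + (b + (length (continuations N h south) + 0)))) (length-words N h) (length-words N (suc h)) ⟩
    pathCount N h + (pathCount N h + (pathCount N (suc h) + (length (continuations N h south) + 0)))
      ≡⟨ cong (λ d → pathCount N h + (pathCount N h + (pathCount N (suc h) + d))) (trans (+-identityʳ _) (length-descents h)) ⟩
    pathCount N h + (pathCount N h + (pathCount N (suc h) + descentCount N h))
      ≡⟨ regroup (pathCount N h) (pathCount N (suc h)) (descentCount N h) ⟩
    pathCount (suc N) h ∎
    where
    open ≡-Reasoning
    length-descents : ∀ h → length (continuations N h south) ≡ descentCount N h
    length-descents zero = refl
    length-descents (suc h) = length-words N h
    regroup : ∀ a b d → a + (a + (b + d)) ≡ a + a + b + d
    regroup a b d = trans (sym (+-assoc a a (b + d))) (sym (+-assoc (a + a) b d))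

  -- In the matrix decoded from w, element i (counted from 0) sits
  -- in row rowOf w i and column colOf w i.
  prefix : (Move → ℕ) → Word → ℕ → ℕ
  prefix δ [] i = 0
  prefix δ (m ∷ w) zero = 0
  prefix δ (m ∷ w) (suc i) = δ m + prefix δ w i

  rowOf colOf : Word → ℕ → ℕ
  rowOf = prefix rowStep
  colOf = prefix colStep

  rowStep≤1 : ∀ m → rowStep m ≤ 1
  rowStep≤1 stay = z≤n
  rowStep≤1 diag = s≤s z≤n
  rowStep≤1 east = z≤n
  rowStep≤1 south = s≤s z≤n

  colStep≤1 : ∀ m → colStep m ≤ 1
  colStep≤1 stay = z≤n
  colStep≤1 diag = s≤s z≤n
  colStep≤1 east = s≤s z≤n
  colStep≤1 south = z≤n

  prefix-zero : ∀ δ w → prefix δ w 0 ≡ 0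
  prefix-zero δ [] = refl
  prefix-zero δ (m ∷ w) = refl

  prefix-mono : ∀ δ w {i j} → i ≤ j → prefix δ w i ≤ prefix δ w j
  prefix-mono δ [] i≤j = z≤n
  prefix-mono δ (m ∷ w) {zero} i≤j = z≤n
  prefix-mono δ (m ∷ w) {suc i} {suc j} (s≤s i≤j) = +-monoʳ-≤ (δ m) (prefix-mono δ w i≤j)

  prefix≤total : ∀ δ w i → prefix δ w i ≤ prefix δ w (length w)
  prefix≤total δ [] i = z≤n
  prefix≤total δ (m ∷ w) zero = z≤n
  prefix≤total δ (m ∷ w) (suc i) = +-monoʳ-≤ (δ m) (prefix≤total δ w i)

  prefix-onto : ∀ δ → (∀ m → δ m ≤ 1) →
    ∀ w r → r ≤ prefix δ w (length w) → ∃[ i ] (i ≤ length w × prefix δ w i ≡ r)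
  prefix-onto δ δ≤1 w zero _ = 0 , z≤n , prefix-zero δ w
  prefix-onto δ δ≤1 (m ∷ w) (suc r) r≤ with δ m in step | δ≤1 m
  ... | zero | _ = let i , i≤ , eq = prefix-onto δ δ≤1 w (suc r) r≤ in
    suc i , s≤s i≤ , trans (cong (_+ prefix δ w i) step) eq
  ... | suc zero | _ = let i , i≤ , eq = prefix-onto δ δ≤1 w r (s≤s⁻¹ r≤) in
    suc i , s≤s i≤ , trans (cong (_+ prefix δ w i) step) (cong suc eq)
  ... | suc (suc _) | s≤s ()

  valid-below : ∀ h w → Valid h w → ∀ i → rowOf w i ≤ h + colOf w i
  valid-below h [] valid i = z≤n
  valid-below h (m ∷ w) valid zero = z≤n
  valid-below h (stay ∷ w) valid (suc i) = valid-below h w valid i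
  valid-below h (diag ∷ w) valid (suc i) =
    subst (suc (rowOf w i) ≤_) (sym (+-suc h (colOf w i))) (s≤s (valid-below h w valid i))
  valid-below h (east ∷ w) valid (suc i) =
    subst (rowOf w i ≤_) (sym (+-suc h (colOf w i))) (valid-below (suc h) w valid i)
  valid-below (suc h) (south ∷ w) valid (suc i) = s≤s (valid-below h w valid i)

  valid-end : ∀ h w → Valid h w → rowOf w (length w) ≡ h + colOf w (length w)
  valid-end h [] valid = sym (trans (+-identityʳ h) valid)
  valid-end h (stay ∷ w) valid = valid-end h w valid
  valid-end h (diag ∷ w) valid = trans (cong suc (valid-end h w valid)) (sym (+-suc h _))
  valid-end h (east ∷ w) valid = trans (valid-end (suc h) w valid) (sym (+-suc h _))
  valid-end (suc h) (south ∷ w) valid = cong suc (valid-end h w valid)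

  valid-intro : ∀ h w → (∀ i → i ≤ length w → rowOf w i ≤ h + colOf w i) →
    rowOf w (length w) ≡ h + colOf w (length w) → Valid h w
  valid-intro h [] below end = sym (trans end (+-identityʳ h))
  valid-intro h (stay ∷ w) below end = valid-intro h w (λ i i≤ → below (suc i) (s≤s i≤)) end
  valid-intro h (diag ∷ w) below end =
    valid-intro h w (λ i i≤ → s≤s⁻¹ (subst (suc (rowOf w i) ≤_) (+-suc h _) (below (suc i) (s≤s i≤))))
      (suc-injective (trans end (+-suc h _)))
  valid-intro h (east ∷ w) below end =
    valid-intro (suc h) w (λ i i≤ → subst (rowOf w i ≤_) (+-suc h _) (below (suc i) (s≤s i≤)))
      (trans end (+-suc h _))
  valid-intro zero (south ∷ w) below end =
    n≮0 (subst₂ _≤_ (cong suc (prefix-zero rowStep w)) (prefix-zero colStep w) (below 1 (s≤s z≤n)))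
  valid-intro (suc h) (south ∷ w) below end =
    valid-intro h w (λ i i≤ → s≤s⁻¹ (below (suc i) (s≤s i≤))) (suc-injective end)

  fromSteps : ℕ → ℕ → Move
  fromSteps zero zero = stay
  fromSteps zero (suc _) = east
  fromSteps (suc _) zero = south
  fromSteps (suc _) (suc _) = diag

  fromSteps-steps : ∀ m → fromSteps (rowStep m) (colStep m) ≡ m
  fromSteps-steps stay = refl
  fromSteps-steps diag = refl
  fromSteps-steps east = refl
  fromSteps-steps south = refl

  rowStep-fromSteps : ∀ {a} b → a ≤ 1 → rowStep (fromSteps a b) ≡ a
  rowStep-fromSteps zero z≤n = refl
  rowStep-fromSteps (suc b) z≤n = refl
  rowStep-fromSteps zero (s≤s z≤n) = refl
  rowStep-fromSteps (suc b) (s≤s z≤n) = refl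

  colStep-fromSteps : ∀ a {b} → b ≤ 1 → colStep (fromSteps a b) ≡ b
  colStep-fromSteps zero z≤n = refl
  colStep-fromSteps (suc a) z≤n = refl
  colStep-fromSteps zero (s≤s z≤n) = refl
  colStep-fromSteps (suc a) (s≤s z≤n) = refl

  word-ext : ∀ w w′ → length w ≡ length w′ →
    (∀ i → i ≤ length w → rowOf w i ≡ rowOf w′ i × colOf w i ≡ colOf w′ i) → w ≡ w′
  word-ext [] [] _ _ = refl
  word-ext (m ∷ w) (m′ ∷ w′) len agree = cong₂ _∷_ m≡m′ (word-ext w w′ (suc-injective len) agree′)
    where
    firstStep : ∀ δ → prefix δ (m ∷ w) 1 ≡ prefix δ (m′ ∷ w′) 1 → δ m ≡ δ m′
    firstStep δ eq = +-cancelʳ-≡ 0 (δ m) (δ m′) (begin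
      δ m + 0                ≡⟨ cong (δ m +_) (prefix-zero δ w) ⟨
      prefix δ (m ∷ w) 1     ≡⟨ eq ⟩
      prefix δ (m′ ∷ w′) 1   ≡⟨ cong (δ m′ +_) (prefix-zero δ w′) ⟩
      δ m′ + 0               ∎)
      where open ≡-Reasoning
    rows : rowStep m ≡ rowStep m′
    rows = firstStep rowStep (proj₁ (agree 1 (s≤s z≤n)))
    cols : colStep m ≡ colStep m′
    cols = firstStep colStep (proj₂ (agree 1 (s≤s z≤n)))
    m≡m′ : m ≡ m′
    m≡m′ = trans (sym (fromSteps-steps m)) (trans (cong₂ fromSteps rows cols) (fromSteps-steps m′))
    agree′ : ∀ i → i ≤ length w → rowOf w i ≡ rowOf w′ i × colOf w i ≡ colOf w′ i
    agree′ i i≤ = let r , c = agree (suc i) (s≤s i≤) in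
      +-cancelˡ-≡ (rowStep m) _ _ (trans r (cong (_+ rowOf w′ i) (sym rows))) ,
      +-cancelˡ-≡ (colStep m) _ _ (trans c (cong (_+ colOf w′ i) (sym cols)))

  UnitSteps : ∀ {N} → (Fin (suc N) → ℕ) → Set
  UnitSteps {N} S = ∀ (k : Fin N) → S (inject₁ k) ≤ S (suc k) × S (suc k) ≤ suc (S (inject₁ k))

  unitIncrement : ∀ {a b} → a ≤ b → b ≤ suc a → b ∸ a ≤ 1
  unitIncrement {a} a≤b b≤1+a = ≤-trans (∸-monoˡ-≤ a b≤1+a) (≤-reflexive (m+n∸n≡m 1 a))

  wordOf : ∀ {N} → (Fin (suc N) → ℕ) → (Fin (suc N) → ℕ) → Word
  wordOf {zero} ρ κ = []
  wordOf {suc N} ρ κ =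
    fromSteps (ρ (suc zero) ∸ ρ zero) (κ (suc zero) ∸ κ zero) ∷ wordOf (ρ ∘ suc) (κ ∘ suc)

  length-wordOf : ∀ {N} (ρ κ : Fin (suc N) → ℕ) → length (wordOf ρ κ) ≡ N
  length-wordOf {zero} ρ κ = refl
  length-wordOf {suc N} ρ κ = cong suc (length-wordOf (ρ ∘ suc) (κ ∘ suc))

  prefix-wordOf : ∀ {N} δ (S ρ κ : Fin (suc N) → ℕ) →
    (∀ (k : Fin N) → S (inject₁ k) + δ (fromSteps (ρ (suc k) ∸ ρ (inject₁ k)) (κ (suc k) ∸ κ (inject₁ k))) ≡ S (suc k)) →
    ∀ i → S zero + prefix δ (wordOf ρ κ) (toℕ i) ≡ S i
  prefix-wordOf {zero} δ S ρ κ increments zero = +-identityʳ (S zero)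
  prefix-wordOf {suc N} δ S ρ κ increments zero = +-identityʳ (S zero)
  prefix-wordOf {suc N} δ S ρ κ increments (suc i) = begin
    S zero + (δ m + prefix δ w (toℕ i))   ≡⟨ +-assoc (S zero) (δ m) _ ⟨
    S zero + δ m + prefix δ w (toℕ i)     ≡⟨ cong (_+ prefix δ w (toℕ i)) (increments zero) ⟩
    S (suc zero) + prefix δ w (toℕ i)     ≡⟨ prefix-wordOf δ (S ∘ suc) (ρ ∘ suc) (κ ∘ suc) (increments ∘ suc) i ⟩
    S (suc i)                             ∎
    where
    open ≡-Reasoning
    m : Move
    m = fromSteps (ρ (suc zero) ∸ ρ zero) (κ (suc zero) ∸ κ zero)
    w : Word
    w = wordOf (ρ ∘ suc) (κ ∘ suc)

  rowOf-wordOf : ∀ {N} (ρ κ : Fin (suc N) → ℕ) → ρ zero ≡ 0 → UnitSteps ρ →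
    ∀ i → rowOf (wordOf ρ κ) (toℕ i) ≡ ρ i
  rowOf-wordOf ρ κ ρ₀≡0 steps i =
    trans (cong (_+ rowOf (wordOf ρ κ) (toℕ i)) (sym ρ₀≡0)) (prefix-wordOf rowStep ρ ρ κ increments i)
    where
    increments : ∀ k → ρ (inject₁ k) + rowStep (fromSteps (ρ (suc k) ∸ ρ (inject₁ k)) _) ≡ ρ (suc k)
    increments k = let lo , hi = steps k in
      trans (cong (ρ (inject₁ k) +_) (rowStep-fromSteps _ (unitIncrement lo hi))) (m+[n∸m]≡n lo)

  colOf-wordOf : ∀ {N} (ρ κ : Fin (suc N) → ℕ) → κ zero ≡ 0 → UnitSteps κ →
    ∀ i → colOf (wordOf ρ κ) (toℕ i) ≡ κ i
  colOf-wordOf ρ κ κ₀≡0 steps i =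
    trans (cong (_+ colOf (wordOf ρ κ) (toℕ i)) (sym κ₀≡0)) (prefix-wordOf colStep κ ρ κ increments i)
    where
    increments : ∀ k → κ (inject₁ k) + colStep (fromSteps _ (κ (suc k) ∸ κ (inject₁ k))) ≡ κ (suc k)
    increments k = let lo , hi = steps k in
      trans (cong (κ (inject₁ k) +_) (colStep-fromSteps _ (unitIncrement lo hi))) (m+[n∸m]≡n lo)

module CellMatrices where

  open import Data.Nat using (ℕ; _≤_; _<_; _≡ᵇ_; s≤s)
  open import Data.Nat.Properties using (≤-trans; <⇒≱; ≰⇒>; ≮⇒≥; ≡ᵇ⇒≡; ≡⇒≡ᵇ)
  open import Data.Fin as F using (Fin; toℕ; fromℕ<)
  open import Data.Fin.Properties using (toℕ-injective; toℕ-fromℕ<; toℕ<n)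
  import Data.Fin.Subset as Subset
  open import Data.Vec using (Vec; lookup; tabulate)
  open import Data.Vec.Properties using (lookup∘tabulate; tabulate∘lookup; tabulate-cong; lookup-replicate; []=⇒lookup; lookup⇒[]=)
  open import Data.Bool using (Bool; true; false; _∧_)
  open import Data.Bool.Properties using (T-≡; T-∧; ¬-not; ⇔→≡)
  open import Data.Product using (∃-syntax; _×_; _,_; proj₁; proj₂)
  open import Function using (_∘_)
  open import Function.Bundles using (_⇔_; mk⇔; Equivalence)
  open import Relation.Nullary using (¬_)
  open import Relation.Binary.PropositionalEquality

  inCell : ℕ → ℕ → ℕ → ℕ → Bool
  inCell a b r c = (a ≡ᵇ r) ∧ (b ≡ᵇ c)

  inCell-sound : ∀ a b r c → inCell a b r c ≡ true → a ≡ r × b ≡ c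
  inCell-sound a b r c eq =
    let ar , bc = Equivalence.to T-∧ (Equivalence.from T-≡ eq) in ≡ᵇ⇒≡ a r ar , ≡ᵇ⇒≡ b c bc

  inCell-complete : ∀ a b r c → a ≡ r → b ≡ c → inCell a b r c ≡ true
  inCell-complete a b r c a≡r b≡c =
    Equivalence.to T-≡ (Equivalence.from T-∧ (≡⇒≡ᵇ a r a≡r , ≡⇒≡ᵇ b c b≡c))

  cellMatrix : ∀ {n} m → (Fin n → ℕ) → (Fin n → ℕ) → SqMat n m
  cellMatrix m ρ κ = tabulate λ r → tabulate λ c → tabulate λ i → inCell (ρ i) (κ i) (toℕ r) (toℕ c)

  lookup-cellMatrix : ∀ {n m} (ρ κ : Fin n → ℕ) r c i →
    lookup (entry (cellMatrix m ρ κ) r c) i ≡ inCell (ρ i) (κ i) (toℕ r) (toℕ c)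
  lookup-cellMatrix ρ κ r c i =
    trans (cong (λ row → lookup row i) (trans (cong (λ rows → lookup rows c) (lookup∘tabulate _ r)) (lookup∘tabulate _ c)))
          (lookup∘tabulate _ i)

  ∈-cellMatrix : ∀ {n m} (ρ κ : Fin n → ℕ) r c i →
    i Subset.∈ entry (cellMatrix m ρ κ) r c ⇔ (ρ i ≡ toℕ r × κ i ≡ toℕ c)
  ∈-cellMatrix ρ κ r c i = mk⇔
    (λ i∈ → inCell-sound _ _ _ _ (trans (sym (lookup-cellMatrix ρ κ r c i)) ([]=⇒lookup i∈)))
    (λ (ρi , κi) → lookup⇒[]= i _ (trans (lookup-cellMatrix ρ κ r c i) (inCell-complete _ _ _ _ ρi κi)))

  vec-ext : ∀ {A : Set} {k} (u v : Vec A k) → (∀ j → lookup u j ≡ lookup v j) → u ≡ v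
  vec-ext u v same = trans (sym (tabulate∘lookup u)) (trans (tabulate-cong same) (tabulate∘lookup v))

  matrix-ext : ∀ {n m} (M M′ : SqMat n m) →
    (∀ r c i → lookup (entry M r c) i ≡ lookup (entry M′ r c) i) → M ≡ M′
  matrix-ext M M′ same = vec-ext M M′ λ r → vec-ext _ _ λ c → vec-ext _ _ λ i → same r c i

  record MonotoneOnto {n} (m : ℕ) (S : Fin n → ℕ) : Set where
    field
      bounded : ∀ i → S i < m
      onto : ∀ v → v < m → ∃[ i ] S i ≡ v
      mono : ∀ {i j} → i F.≤ j → S i ≤ S j

    reflects< : ∀ {i j} → S i < S j → i F.< j
    reflects< Si<Sj = ≰⇒> λ j≤i → <⇒≱ Si<Sj (mono j≤i)

  record MonoCoordinates {n} (m : ℕ) (ρ κ : Fin n → ℕ) : Set where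
    field
      rows : MonotoneOnto m ρ
      cols : MonotoneOnto m κ
      upper : ∀ i → ρ i ≤ κ i

  module _ {n m} {ρ κ : Fin n → ℕ} (coords : MonoCoordinates m ρ κ) where
    open MonoCoordinates coords

    private
      M : SqMat n m
      M = cellMatrix m ρ κ
      ρ-of : ∀ {i r c} → i Subset.∈ entry M r c → ρ i ≡ toℕ r
      ρ-of i∈ = proj₁ (Equivalence.to (∈-cellMatrix ρ κ _ _ _) i∈)
      κ-of : ∀ {i r c} → i Subset.∈ entry M r c → κ i ≡ toℕ c
      κ-of i∈ = proj₂ (Equivalence.to (∈-cellMatrix ρ κ _ _ _) i∈)
      ∈-M : ∀ {i} (r c : Fin m) → ρ i ≡ toℕ r → κ i ≡ toℕ c → i Subset.∈ entry M r c
      ∈-M r c ρi κi = Equivalence.from (∈-cellMatrix ρ κ r c _) (ρi , κi)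
      rowFin colFin : Fin n → Fin m
      rowFin i = fromℕ< (≤-trans (s≤s (upper i)) (MonotoneOnto.bounded cols i))
      colFin i = fromℕ< (MonotoneOnto.bounded cols i)
      ∈-cell : ∀ i → i Subset.∈ entry M (rowFin i) (colFin i)
      ∈-cell i = ∈-M (rowFin i) (colFin i) (sym (toℕ-fromℕ< _)) (sym (toℕ-fromℕ< _))

    cellMatrix-partition : IsPartitionMatrix M
    cellMatrix-partition = record
      { upperTriangular = λ r c c<r → vec-ext _ _ λ i →
          trans (¬-not λ bit → let i∈ = lookup⇒[]= i _ bit in <⇒≱ c<r (subst₂ _≤_ (ρ-of i∈) (κ-of i∈) (upper i)))
                (sym (lookup-replicate i false))
      ; rowNonempty = λ r → let i , ρi = MonotoneOnto.onto rows (toℕ r) (toℕ<n r) in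
          colFin i , i , ∈-M r (colFin i) ρi (sym (toℕ-fromℕ< _))
      ; colNonempty = λ c → let i , κi = MonotoneOnto.onto cols (toℕ c) (toℕ<n c) in
          rowFin i , i , ∈-M (rowFin i) c (sym (toℕ-fromℕ< _)) κi
      ; covers = λ i → rowFin i , colFin i , ∈-cell i
      ; disjoint = λ i r c r′ c′ i∈ i∈′ →
          toℕ-injective (trans (sym (ρ-of i∈)) (ρ-of i∈′)) , toℕ-injective (trans (sym (κ-of i∈)) (κ-of i∈′))
      ; colOrder = λ i j r c r′ c′ i∈ j∈ c<c′ →
          MonotoneOnto.reflects< cols (subst₂ _<_ (sym (κ-of i∈)) (sym (κ-of j∈)) c<c′)
      }

    cellMatrix-mono : IsMono (m , M)
    cellMatrix-mono = record
      { partitionMatrix = cellMatrix-partition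
      ; rowOrder = λ i j r c r′ c′ i∈ j∈ r<r′ →
          MonotoneOnto.reflects< rows (subst₂ _<_ (sym (ρ-of i∈)) (sym (ρ-of j∈)) r<r′)
      }

  cellMatrix-injective : ∀ {n m m′} {ρ κ ρ′ κ′ : Fin n → ℕ} →
    _≡_ {A = Matrix n} (m , cellMatrix m ρ κ) (m′ , cellMatrix m′ ρ′ κ′) →
    ∀ i → ρ i < m → κ i < m → ρ i ≡ ρ′ i × κ i ≡ κ′ i
  cellMatrix-injective {n} {ρ = ρ} {κ} {ρ′} {κ′} same i ρi<m κi<m with subst InCellOf same inFirst
    where
    InCellOf : Matrix n → Set
    InCellOf (k , A) = ∃[ r ] ∃[ c ] (i Subset.∈ entry A r c × toℕ r ≡ ρ i × toℕ c ≡ κ i)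
    inFirst : InCellOf (_ , cellMatrix _ ρ κ)
    inFirst = fromℕ< ρi<m , fromℕ< κi<m ,
      Equivalence.from (∈-cellMatrix ρ κ _ _ i) (sym (toℕ-fromℕ< ρi<m) , sym (toℕ-fromℕ< κi<m)) ,
      toℕ-fromℕ< ρi<m , toℕ-fromℕ< κi<m
  ... | r , c , i∈ , r≡ , c≡ = let ρ′i , κ′i = Equivalence.to (∈-cellMatrix ρ′ κ′ r c i) i∈ in
    trans (sym r≡) (sym ρ′i) , trans (sym c≡) (sym κ′i)

  cellMatrix-cong : ∀ {n m m′} {ρ κ ρ′ κ′ : Fin n → ℕ} → m ≡ m′ →
    (∀ i → ρ i ≡ ρ′ i) → (∀ i → κ i ≡ κ′ i) →
    _≡_ {A = Matrix n} (m , cellMatrix m ρ κ) (m′ , cellMatrix m′ ρ′ κ′)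
  cellMatrix-cong {ρ = ρ} {κ} {ρ′} {κ′} refl ρ≗ρ′ κ≗κ′ = cong (_ ,_) (matrix-ext _ _ λ r c i →
    trans (lookup-cellMatrix ρ κ r c i)
      (trans (cong₂ (λ a b → inCell a b (toℕ r) (toℕ c)) (ρ≗ρ′ i) (κ≗κ′ i)) (sym (lookup-cellMatrix ρ′ κ′ r c i))))

  finOnto-monotoneOnto : ∀ {n m} (F : Fin n → Fin m) → (∀ r → ∃[ j ] F j ≡ r) →
    (∀ {i j} → F i F.< F j → i F.< j) → MonotoneOnto m (toℕ ∘ F)
  finOnto-monotoneOnto F onto reflects = record
    { bounded = λ i → toℕ<n (F i)
    ; onto = λ v v<m → let j , Fj≡ = onto (fromℕ< v<m) in j , trans (cong toℕ Fj≡) (toℕ-fromℕ< v<m)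
    ; mono = λ i≤j → ≮⇒≥ λ Fj<Fi → <⇒≱ (reflects Fj<Fi) i≤j
    }

  -- In a partition matrix each element lies in exactly one cell, so the matrix is
  -- the cellMatrix of the coordinates of that cell.
  module Located {n m} {M : SqMat n m} (partition : IsPartitionMatrix M) where
    open IsPartitionMatrix partition

    rowIdx colIdx : Fin n → Fin m
    rowIdx i = proj₁ (covers i)
    colIdx i = proj₁ (proj₂ (covers i))

    ∈-located : ∀ i → i Subset.∈ entry M (rowIdx i) (colIdx i)
    ∈-located i = proj₂ (proj₂ (covers i))

    located-unique : ∀ {i r c} → i Subset.∈ entry M r c → rowIdx i ≡ r × colIdx i ≡ c
    located-unique i∈ = disjoint _ _ _ _ _ (∈-located _) i∈

    ρ κ : Fin n → ℕ
    ρ = toℕ ∘ rowIdx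
    κ = toℕ ∘ colIdx

    partition≡cellMatrix : M ≡ cellMatrix m ρ κ
    partition≡cellMatrix = matrix-ext M (cellMatrix m ρ κ) λ r c i →
      trans (⇔→≡ {z = true} (mk⇔ (toCell r c i) (fromCell r c i))) (sym (lookup-cellMatrix ρ κ r c i))
      where
      toCell : ∀ r c i → lookup (entry M r c) i ≡ true → inCell (ρ i) (κ i) (toℕ r) (toℕ c) ≡ true
      toCell r c i bit = let r≡ , c≡ = located-unique (lookup⇒[]= i _ bit) in
        inCell-complete _ _ _ _ (cong toℕ r≡) (cong toℕ c≡)
      fromCell : ∀ r c i → inCell (ρ i) (κ i) (toℕ r) (toℕ c) ≡ true → lookup (entry M r c) i ≡ true
      fromCell r c i bit = let r≡ , c≡ = inCell-sound _ _ _ _ bit in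
        []=⇒lookup (subst₂ (λ r′ c′ → i Subset.∈ entry M r′ c′) (toℕ-injective r≡) (toℕ-injective c≡) (∈-located i))

    rowIdx-onto : ∀ r → ∃[ j ] rowIdx j ≡ r
    rowIdx-onto r = let c , j , j∈ = rowNonempty r in j , proj₁ (located-unique j∈)

    colIdx-onto : ∀ c → ∃[ j ] colIdx j ≡ c
    colIdx-onto c = let r , j , j∈ = colNonempty c in j , proj₂ (located-unique j∈)

    located-upper : ∀ i → ρ i ≤ κ i
    located-upper i = ≮⇒≥ λ c<r → outside (subst (i Subset.∈_) (upperTriangular _ _ c<r) (∈-located i))
      where
      outside : ¬ (i Subset.∈ Subset.⊥)
      outside i∈⊥ with trans (sym ([]=⇒lookup i∈⊥)) (lookup-replicate i false)
      ... | ()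

  mono-coordinates : ∀ {n m} {M : SqMat n m} (mono : IsMono (m , M)) →
    let open Located (IsMono.partitionMatrix mono) in MonoCoordinates m ρ κ
  mono-coordinates mono = record
    { rows = finOnto-monotoneOnto rowIdx rowIdx-onto λ r<r′ →
        rowOrder _ _ _ _ _ _ (∈-located _) (∈-located _) r<r′
    ; cols = finOnto-monotoneOnto colIdx colIdx-onto λ c<c′ →
        colOrder _ _ _ _ _ _ (∈-located _) (∈-located _) c<c′
    ; upper = located-upper
    }
    where
    open IsMono mono
    open IsPartitionMatrix partitionMatrix using (colOrder)
    open Located partitionMatrix

module Decoding where

  open import Data.Nat as ℕ using (ℕ; suc; _≤_; _<_; z≤n; s≤s)
  open import Data.Nat.Properties using (≤-trans; ≤-antisym; <-trans; ≤-<-connex; <⇒≱; ≮⇒≥; n≤0⇒n≡0; suc-injective; n≤1+n; n≮n)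
  open import Data.Fin as F using (Fin; toℕ; fromℕ; fromℕ<; inject₁)
  open import Data.Fin.Properties using (toℕ-fromℕ<; toℕ-fromℕ; toℕ<n; toℕ-inject₁)
  open import Data.List using (length)
  open import Data.Product using (∃-syntax; _×_; _,_)
  open import Data.Sum using (inj₁; inj₂)
  open import Relation.Nullary using (¬_)
  open import Function using (_∘_)
  open import Relation.Binary.PropositionalEquality
  open MoveWords
  open CellMatrices

  module _ {N m} {S : Fin (suc N) → ℕ} (S-onto : MonotoneOnto m S) where
    open MonotoneOnto S-onto

    onto-start : S F.zero ≡ 0
    onto-start = let j , Sj≡0 = onto 0 (≤-trans (s≤s z≤n) (bounded F.zero)) in
      n≤0⇒n≡0 (subst (S F.zero ≤_) Sj≡0 (mono z≤n))

    onto-end : suc (S (fromℕ N)) ≡ m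
    onto-end = ≤-antisym (bounded (fromℕ N)) (≮⇒≥ beyondLast)
      where
      -- a value above S at the last element would have no preimage
      beyondLast : ¬ (suc (S (fromℕ N)) < m)
      beyondLast above with onto (suc (S (fromℕ N))) above
      ... | j , Sj≡ = n≮n _ (subst (_≤ S (fromℕ N)) Sj≡ (mono (subst (toℕ j ≤_) (sym (toℕ-fromℕ N)) (ℕ.s≤s⁻¹ (toℕ<n j)))))

    onto-steps : UnitSteps S
    onto-steps k = mono (subst (_≤ suc (toℕ k)) (sym (toℕ-inject₁ k)) (n≤1+n _)) , ≮⇒≥ skips
      where
      -- a value strictly between S k and S (k+1) would have no preimage
      skips : ¬ (suc (S (inject₁ k)) < S (F.suc k))
      skips gap with onto (suc (S (inject₁ k))) (<-trans gap (bounded (F.suc k)))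
      ... | j , Sj≡ with ≤-<-connex (toℕ j) (toℕ k)
      ... | inj₁ j≤k = n≮n _ (subst (_≤ S (inject₁ k)) Sj≡ (mono (subst (toℕ j ≤_) (sym (toℕ-inject₁ k)) j≤k)))
      ... | inj₂ k<j = <⇒≱ gap (subst (S (F.suc k) ≤_) Sj≡ (mono k<j))

  decode : ∀ n → Word → Matrix n
  decode n w = suc (colOf w (length w)) , cellMatrix _ (rowOf w ∘ toℕ) (colOf w ∘ toℕ)

  prefix-monotoneOnto : ∀ δ → (∀ m → δ m ≤ 1) → ∀ w {K} → prefix δ w (length w) ≡ K →
    MonotoneOnto (suc K) (prefix δ w ∘ toℕ {suc (length w)})
  prefix-monotoneOnto δ δ≤1 w refl = record
    { bounded = λ i → s≤s (prefix≤total δ w (toℕ i))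
    ; onto = λ v v≤ → let i , i≤ , prefix≡v = prefix-onto δ δ≤1 w v (ℕ.s≤s⁻¹ v≤) in
        fromℕ< (s≤s i≤) , trans (cong (prefix δ w) (toℕ-fromℕ< (s≤s i≤))) prefix≡v
    ; mono = prefix-mono δ w
    }

  word-coordinates : ∀ w → Valid 0 w →
    MonoCoordinates (suc (colOf w (length w))) (rowOf w ∘ toℕ {suc (length w)}) (colOf w ∘ toℕ)
  word-coordinates w valid = record
    { rows = prefix-monotoneOnto rowStep rowStep≤1 w (valid-end 0 w valid)
    ; cols = prefix-monotoneOnto colStep colStep≤1 w refl
    ; upper = λ i → valid-below 0 w valid (toℕ i)
    }

  decode-mono : ∀ {N} w → length w ≡ N → Valid 0 w → IsMono (decode (suc N) w)
  decode-mono w refl valid = cellMatrix-mono (word-coordinates w valid)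

  -- Decoding is injective on valid words: the matrix determines every prefix sum.
  decode-injective : ∀ {N} w w′ → length w ≡ N → length w′ ≡ N → Valid 0 w →
    decode (suc N) w ≡ decode (suc N) w′ → w ≡ w′
  decode-injective w w′ refl len′ valid same = word-ext w w′ (sym len′) agree
    where
    open MonoCoordinates (word-coordinates w valid)
    agree : ∀ k → k ≤ length w → rowOf w k ≡ rowOf w′ k × colOf w k ≡ colOf w′ k
    agree k k≤ = subst (λ k → rowOf w k ≡ rowOf w′ k × colOf w k ≡ colOf w′ k) (toℕ-fromℕ< (s≤s k≤))
      (cellMatrix-injective {ρ = rowOf w ∘ toℕ} {colOf w ∘ toℕ} {rowOf w′ ∘ toℕ} {colOf w′ ∘ toℕ}
        same i (MonotoneOnto.bounded rows i) (MonotoneOnto.bounded cols i))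
      where
      i : Fin (suc (length w))
      i = fromℕ< (s≤s k≤)

  coordinates-word : ∀ {N m} {ρ κ : Fin (suc N) → ℕ} → MonoCoordinates m ρ κ →
    length (wordOf ρ κ) ≡ N × Valid 0 (wordOf ρ κ) × decode (suc N) (wordOf ρ κ) ≡ (m , cellMatrix m ρ κ)
  coordinates-word {N} {m} {ρ} {κ} coords = length-wordOf ρ κ , valid , decoded
    where
    open MonoCoordinates coords
    w : Word
    w = wordOf ρ κ
    rowOf-w : ∀ i → rowOf w (toℕ i) ≡ ρ i
    rowOf-w = rowOf-wordOf ρ κ (onto-start rows) (onto-steps rows)
    colOf-w : ∀ i → colOf w (toℕ i) ≡ κ i
    colOf-w = colOf-wordOf ρ κ (onto-start cols) (onto-steps cols)
    position : ∀ {k} → k ≤ length w → Fin (suc N)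
    position k≤ = fromℕ< (s≤s (subst (_ ≤_) (length-wordOf ρ κ) k≤))
    length≡last : length w ≡ toℕ (fromℕ N)
    length≡last = trans (length-wordOf ρ κ) (sym (toℕ-fromℕ N))
    lastCol : suc (colOf w (length w)) ≡ m
    lastCol = trans (cong (suc ∘ colOf w) length≡last) (trans (cong suc (colOf-w _)) (onto-end cols))
    lastRow : suc (rowOf w (length w)) ≡ m
    lastRow = trans (cong (suc ∘ rowOf w) length≡last) (trans (cong suc (rowOf-w _)) (onto-end rows))
    valid : Valid 0 w
    valid = valid-intro 0 w below (suc-injective (trans lastRow (sym lastCol)))
      where
      below : ∀ k → k ≤ length w → rowOf w k ≤ colOf w k
      below k k≤ = subst₂ (λ a b → rowOf w a ≤ colOf w b) toℕ-position toℕ-position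
        (subst₂ _≤_ (sym (rowOf-w (position k≤))) (sym (colOf-w (position k≤))) (upper (position k≤)))
        where
        toℕ-position : toℕ (position k≤) ≡ k
        toℕ-position = toℕ-fromℕ< _
    decoded : decode (suc N) w ≡ (m , cellMatrix m ρ κ)
    decoded = cellMatrix-cong lastCol rowOf-w colOf-w

  mono-decode : ∀ {N} (A : Matrix (suc N)) → IsMono A →
    ∃[ w ] (length w ≡ N × Valid 0 w × A ≡ decode (suc N) w)
  mono-decode (m , M) mono =
    let len , valid , decoded = coordinates-word {ρ = ρ} {κ} (mono-coordinates mono) in
    wordOf ρ κ , len , valid , trans (cong (m ,_) partition≡cellMatrix) (sym decoded)
    where
    open Located (IsMono.partitionMatrix mono)

open Counting
open ListEnumeration
open MoveWords
open CellMatrices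
open Decoding

proposition9 : ∀ (n : ℕ) → n ≥ 1 →
    ∃[ L ] (Unique L × (∀ (A : Matrix n) → (A ∈ L ⇔ IsMono A)) × length L ≡ catalan n)
proposition9 (suc N) _ = map (decode (suc N)) (words N 0) , unique , members , count
  where
  unique : Unique (map (decode (suc N)) (words N 0))
  unique = map-unique (decode (suc N)) (λ w∈ w′∈ same →
      decode-injective _ _ (proj₁ (words-sound N 0 w∈)) (proj₁ (words-sound N 0 w′∈)) (proj₂ (words-sound N 0 w∈)) same)
    (words-unique N 0)
  members : ∀ A → A ∈ map (decode (suc N)) (words N 0) ⇔ IsMono A
  members A = mk⇔
    (λ A∈ → let w , w∈ , A≡ = ∈-map⁻ (decode (suc N)) A∈ ; len , valid = words-sound N 0 w∈ in
      subst IsMono (sym A≡) (decode-mono w len valid))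
    (λ mono → let w , len , valid , A≡ = mono-decode A mono in
      subst (_∈ _) (sym A≡) (∈-map⁺ (decode (suc N)) (words-complete N 0 w len valid)))
  count : length (map (decode (suc N)) (words N 0)) ≡ catalan (suc N)
  count = trans (length-map (decode (suc N)) (words N 0)) (trans (length-words N 0) (sym (catalan≡pathCount N)))
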